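{- Let $O$ and $O'$ be Toeplitz subshifts over the alphabet $\mathfrak{n}$ and let $\pi:O\to O'$ be a topological conjugacy with $\pi(\alpha)=\beta$, where $\alpha\in O$ and $\beta\in O'$. Then for every $p\in\mathbb{N}^+$ such that $[-|\pi|,|\pi|]\subseteq Per_p(\alpha)$ and $[-|\pi|,|\pi|]\subseteq Per_p(\beta)$, there exists a permutation $\phi$ of the set $\mathfrak{n}^p$ of words of length $p$ such that $\phi(\alpha[kp,(k+1)p))=\beta[kp,(k+1)p)$ for all $k\in\mathbb{Z}$.
   Context: $\mathfrak{n}=\{0,\dots,\mathfrak{n}-1\}$ is a finite alphabet with $\mathfrak{n}\ge2$; $\sigma$ is the left shift $(\sigma\alpha)(i)=\alpha(i+1)$ on $\mathfrak{n}^{\mathbb{Z}}$. A subshift is an infinite closed $O\subseteq\mathfrak{n}^{\mathbb{Z}}$ with $\sigma[O]=O$; a topological conjugacy is a homeomorphism commuting with $\sigma$. For $\alpha\in\mathfrak{n}^{\mathbb{Z}}$, $\alpha[k,l)=(\alpha(k),\dots,\alpha(l-1))$ and $\alpha[k,l]=(\alpha(k),\dots,\alpha(l))$. $Per_p(\alpha)=\{i\in\mathbb{Z}:\forall k\in\mathbb{Z}\ \alpha(i+pk)=\alpha(i)\}$. A Toeplitz sequence is a non-periodic $\alpha$ with $\bigcup_{p\ge1}Per_p(\alpha)=\mathbb{Z}$; a Toeplitz subshift is the $\sigma$-orbit closure of a Toeplitz sequence. A block code of length $i$ is a map $C:\mathfrak{n}^{2i+1}\to\mathfrak{n}$; it induces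 a shift-commuting continuous map $\pi$ if $(\pi(\gamma))(k)=C(\gamma[k-i,k+i])$ for all $k$ and $\gamma$ (every such $\pi$ between subshifts is induced by some block code). For a topological conjugacy $\pi$, $|\pi|=\max\{\min\{|C|:C\text{ induces }\pi\},\min\{|C|:C\text{ induces }\pi^{ -1}\}\}$. -}

module Defs where

open import Data.Nat as ℕ using (ℕ; suc; _⊔_)
open import Data.Integer as ℤ using (ℤ; +_; -_; _+_; _*_; _-_; _≤_)
open import Data.Fin using (Fin; toℕ)
open import Data.Vec using (Vec; tabulate)
open import Data.Product using (Σ; ∃; _×_)
open import Relation.Nullary using (¬_)
open import Relation.Binary.PropositionalEquality using (_≡_)

Seq : ℕ → Set
Seq n = ℤ → Fin n

σ : ∀ {n} → Seq n → Seq n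
σ α i = α (i + + 1)

Per : ∀ {n} → ℕ → Seq n → ℤ → Set
Per p α i = ∀ (k : ℤ) → α (i + + p * k) ≡ α i

Periodic : ∀ {n} → Seq n → Set
Periodic α = Σ ℕ λ p → (1 ℕ.≤ p) × (∀ (i : ℤ) → α (i + + p) ≡ α i)

Toeplitz : ∀ {n} → Seq n → Set
Toeplitz α = (¬ Periodic α) × (∀ (i : ℤ) → Σ ℕ λ p → (1 ℕ.≤ p) × Per p α i)

-- Orbit closure of τ in the product topology: γ lies in the closure of
-- {σ^j τ : j ∈ ℤ} iff every central window of γ occurs in τ.
OrbitClosure : ∀ {n} → Seq n → Seq n → Set
OrbitClosure τ γ =
  ∀ (m : ℕ) → Σ ℤ λ j → ∀ (i : ℤ) → - (+ m) ≤ i → i ≤ + m → γ i ≡ τ (j + i)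

Subset : ℕ → Set₁
Subset n = Seq n → Set

ToeplitzSubshift : ∀ {n} → Seq n → Set
ToeplitzSubshift τ = Toeplitz τ

window : ∀ {n} → Seq n → ℤ → (i : ℕ) → Vec (Fin n) (suc (2 ℕ.* i))
window γ k i = tabulate λ j → γ ((k - + i) + + toℕ j)

word : ∀ {n} → Seq n → ℤ → (p : ℕ) → Vec (Fin n) p
word α k p = tabulate λ j → α (k + + toℕ j)

BlockCode : ℕ → ℕ → Set
BlockCode n i = Vec (Fin n) (suc (2 ℕ.* i)) → Fin n

Induces : ∀ {n} (O : Subset n) (i : ℕ) → BlockCode n i → (Seq n → Seq n) → Set
Induces O i C π = ∀ γ → O γ → ∀ (k : ℤ) → π γ k ≡ C (window γ k i)

InducedByLength : ∀ {n} (O : Subset n) → ℕ → (Seq n → Seq n) → Set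
InducedByLength {n} O i π = Σ (BlockCode n i) λ C → Induces O i C π

MinCodeLength : ∀ {n} (O : Subset n) → (Seq n → Seq n) → ℕ → Set
MinCodeLength O π a =
  InducedByLength O a π × (∀ b → b ℕ.< a → ¬ InducedByLength O b π)

-- Maps are modelled as
-- functions on the full shift whose values off the domain are irrelevant.
-- Continuity + shift-commutation are expressed (Curtis–Hedlund–Lyndon) by being
-- induced by a block code; a continuous bijection of compact spaces is a
-- homeomorphism, and the inverse is recorded explicitly.
record Conjugacy {n} (O O' : Subset n) : Set where
  field
    π        : Seq n → Seq n
    π⁻¹      : Seq n → Seq n
    maps     : ∀ γ → O γ → O' (π γ)
    maps⁻¹   : ∀ γ → O' γ → O (π⁻¹ γ)
    left-inv  : ∀ γ → O γ → ∀ k → π⁻¹ (π γ) k ≡ γ k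
    right-inv : ∀ γ → O' γ → ∀ k → π (π⁻¹ γ) k ≡ γ k
    π-code   : Σ ℕ λ i → InducedByLength O i π
    π⁻¹-code : Σ ℕ λ i → InducedByLength O' i π⁻¹

ConjNorm : ∀ {n} {O O' : Subset n} → Conjugacy O O' → ℕ → Set
ConjNorm {O = O} {O'} c N =
  Σ ℕ λ a → Σ ℕ λ a' → MinCodeLength O (Conjugacy.π c) a
    × MinCodeLength O' (Conjugacy.π⁻¹ c) a' × N ≡ a ⊔ a'

{-# OPTIONS --safe #-}
-- Since α is p-periodic on [-N, N], on each block [kp, kp + p) and the N
-- letters on either side α coincides with the p-periodic extension of
-- α[kp, kp + p).  Hence the block code C of π, applied cyclically, is a fixed
-- map F on words with F(α[kp, kp + p)) = β[kp, kp + p); likewise the code of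
-- π⁻¹ gives G with G(β[kp, kp + p)) = α[kp, kp + p).  So G ∘ F fixes every
-- p-block of α, F is injective on these blocks, and an injective map on part
-- of the finite set of words extends to a permutation of it.
module Submission where

open import Defs
open import Data.Nat using (ℕ; _≤_)
open import Data.Integer as ℤ using (ℤ; +_; -_; _*_)
open import Data.Fin using (Fin)
open import Data.Vec using (Vec)
open import Data.Product using (Σ; _×_)
open import Function.Bundles using (_↔_; Inverse)
open import Relation.Binary.PropositionalEquality using (_≡_)

import Data.Nat as ℕ
open import Data.Nat using (NonZero; >-nonZero)
import Data.Nat.Properties as ℕ
open import Data.Nat.DivMod using (m<n⇒m%n≡m)
open import Data.Integer using (_+_; _-_; -[1+_]; -≤+; +≤+; +<+; _%ℕ_; _/ℕ_)
import Data.Integer.Properties as ℤ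
open import Data.Integer.Tactic.RingSolver using (solve-∀)
open import Data.Nat.Tactic.RingSolver using () renaming (solve-∀ to solve-∀ᴺ)
open import Data.Integer.DivMod using (n%ℕd<d; a≡a%ℕn+[a/ℕn]*n)
open import Data.Empty using (⊥-elim)
open import Data.Fin using (toℕ; fromℕ<)
open import Data.Fin.Properties using (toℕ<n; toℕ≤pred[n]; toℕ-fromℕ<) renaming (_≟_ to _≟ᶠ_)
open import Data.Vec using ([]; _∷_; lookup)
open import Data.Vec.Properties using (tabulate-cong; lookup∘tabulate) renaming (≡-dec to ≡-decᵛ)
import Data.List as List
open import Data.List using (List; [_]; cartesianProductWith; filter; allFin)
open import Data.List.Membership.Propositional using (_∈_)
open import Data.List.Membership.Propositional.Properties
  using (∈-allFin; ∈-cartesianProductWith⁺; ∈-filter⁺; ∈-filter⁻)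
open import Data.List.Relation.Unary.Any using (here; there)
open import Data.Product using (_,_; proj₂)
open import Function.Bundles using (mk↔ₛ′)
open import Function.Construct.Identity using (↔-id)
open import Function.Construct.Composition using (_↔-∘_)
open import Relation.Nullary using (yes; no)
open import Relation.Binary.Definitions using (DecidableEquality)
open import Relation.Binary.PropositionalEquality
  using (_≢_; _≗_; refl; sym; trans; cong; subst; subst₂; module ≡-Reasoning)
open import Relation.Unary using (Decidable)

module _ {A : Set} (_≟_ : DecidableEquality A) where

  swap : A → A → A → A
  swap a b x with x ≟ a
  ... | yes _ = b
  ... | no _ with x ≟ b
  ...   | yes _ = a
  ...   | no _  = x

  swap-≡ˡ : ∀ a b → swap a b a ≡ b
  swap-≡ˡ a b with a ≟ a
  ... | yes _   = refl
  ... | no a≢a = ⊥-elim (a≢a refl)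

  swap-≡ʳ : ∀ a b → swap a b b ≡ a
  swap-≡ʳ a b with b ≟ a
  ... | yes refl = refl
  ... | no _ with b ≟ b
  ...   | yes _   = refl
  ...   | no b≢b = ⊥-elim (b≢b refl)

  swap-≢ : ∀ {a b x} → x ≢ a → x ≢ b → swap a b x ≡ x
  swap-≢ {a} {b} {x} x≢a x≢b with x ≟ a
  ... | yes x≡a = ⊥-elim (x≢a x≡a)
  ... | no _ with x ≟ b
  ...   | yes x≡b = ⊥-elim (x≢b x≡b)
  ...   | no _    = refl

  swap-involutive : ∀ a b x → swap a b (swap a b x) ≡ x
  swap-involutive a b x with x ≟ a
  ... | yes refl = swap-≡ʳ x b
  ... | no x≢a with x ≟ b
  ...   | yes refl = swap-≡ˡ a x
  ...   | no x≢b   = swap-≢ x≢a x≢b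

  transposition : A → A → A ↔ A
  transposition a b = mk↔ₛ′ (swap a b) (swap a b) (swap-involutive a b) (swap-involutive a b)

  -- Compose with the transposition of to φ x and F x; by injectivity of F on
  -- the list it fixes the images F y already placed.
  ↔-extending-injectiveOn : (F : A → A) (xs : List A) →
    (∀ {x y} → x ∈ xs → y ∈ xs → F x ≡ F y → x ≡ y) →
    Σ (A ↔ A) λ φ → ∀ {x} → x ∈ xs → Inverse.to φ x ≡ F x
  ↔-extending-injectiveOn F List.[] _ = ↔-id A , λ ()
  ↔-extending-injectiveOn F (x List.∷ xs) F-injectiveOn
    with ↔-extending-injectiveOn F xs (λ u v → F-injectiveOn (there u) (there v))
  ... | φ , φ-agrees = transposition (to x) (F x) ↔-∘ φ , agrees
    where
    open ≡-Reasoning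
    open Inverse φ using (to; from; strictlyInverseʳ)

    agrees : ∀ {y} → y ∈ x List.∷ xs → swap (to x) (F x) (to y) ≡ F y
    agrees (here refl) = swap-≡ˡ (to x) (F x)
    agrees {y} (there y∈xs) with y ≟ x
    ... | yes refl = swap-≡ˡ (to x) (F x)
    ... | no y≢x   = begin
      swap (to x) (F x) (to y) ≡⟨ cong (swap (to x) (F x)) (φ-agrees y∈xs) ⟩
      swap (to x) (F x) (F y)  ≡⟨ swap-≢ Fy≢φx Fy≢Fx ⟩
      F y                      ∎
      where
      Fy≢φx : F y ≢ to x
      Fy≢φx Fy≡φx = y≢x (begin
        y           ≡⟨ sym (strictlyInverseʳ y) ⟩
        from (to y) ≡⟨ cong from (trans (φ-agrees y∈xs) Fy≡φx) ⟩
        from (to x) ≡⟨ strictlyInverseʳ x ⟩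
        x           ∎)
      Fy≢Fx : F y ≢ F x
      Fy≢Fx Fy≡Fx = y≢x (F-injectiveOn (there y∈xs) (here refl) Fy≡Fx)

  ↔-extending-retraction : (xs : List A) → (∀ x → x ∈ xs) → (F G : A → A) →
    Σ (A ↔ A) λ φ → ∀ x → G (F x) ≡ x → Inverse.to φ x ≡ F x
  ↔-extending-retraction xs enumerates F G =
    let (φ , φ-agrees) = ↔-extending-injectiveOn F (filter retracts? xs) F-injectiveOn
    in  φ , λ x GFx≡x → φ-agrees (∈-filter⁺ retracts? (enumerates x) GFx≡x)
    where
    retracts? : Decidable (λ x → G (F x) ≡ x)
    retracts? x = G (F x) ≟ x

    retracted : ∀ {x} → x ∈ filter retracts? xs → G (F x) ≡ x
    retracted x∈ = proj₂ (∈-filter⁻ retracts? {xs = xs} x∈)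

    F-injectiveOn : ∀ {x y} → x ∈ filter retracts? xs → y ∈ filter retracts? xs → F x ≡ F y → x ≡ y
    F-injectiveOn x∈ y∈ Fx≡Fy = trans (sym (retracted x∈)) (trans (cong G Fx≡Fy) (retracted y∈))

vectors : ∀ {A : Set} → List A → (p : ℕ) → List (Vec A p)
vectors xs ℕ.zero    = [ [] ]
vectors xs (ℕ.suc p) = cartesianProductWith _∷_ xs (vectors xs p)

∈-vectors : ∀ {A : Set} {xs : List A} → (∀ x → x ∈ xs) → ∀ {p} (v : Vec A p) → v ∈ vectors xs p
∈-vectors enumerates []       = here refl
∈-vectors enumerates (x ∷ v) = ∈-cartesianProductWith⁺ _∷_ (enumerates x) (∈-vectors enumerates v)

blockMap : ∀ {n} i → BlockCode n i → Seq n → Seq n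
blockMap i C γ k = C (window γ k i)

periodicExtension : ∀ {A : Set} p .{{_ : NonZero p}} → Vec A p → ℤ → A
periodicExtension p w x = lookup w (fromℕ< (n%ℕd<d x p))

cyclicCode : ∀ {n} i p .{{_ : NonZero p}} → BlockCode n i → Vec (Fin n) p → Vec (Fin n) p
cyclicCode i p C w = word (blockMap i C (periodicExtension p w)) (+ 0) p

periodicExtension-word : ∀ {n} p .{{_ : NonZero p}} (γ : Seq n) k x →
  periodicExtension p (word γ k p) x ≡ γ (k + + (x %ℕ p))
periodicExtension-word p γ k x =
  trans (lookup∘tabulate (λ j → γ (k + + toℕ j)) (fromℕ< (n%ℕd<d x p)))
        (cong (λ r → γ (k + + r)) (toℕ-fromℕ< (n%ℕd<d x p)))

window-offset-bounds : ∀ {p a j t} → j ℕ.< p → t ℕ.≤ 2 ℕ.* a →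
  - (+ a) ℤ.≤ + j - + a + + t × + j - + a + + t ℤ.< + p + + a
window-offset-bounds {p} {a} {j} {t} j<p t≤2a =
  subst (- (+ a) ℤ.≤_) (sym offset) (ℤ.i≤i+j (- (+ a)) (+ (j ℕ.+ t))) ,
  subst₂ ℤ._<_ (sym offset) (cancel (+ p) (+ a))
    (ℤ.+-monoʳ-< (- (+ a)) (+<+ (subst (j ℕ.+ t ℕ.<_) (double p a) (ℕ.+-mono-<-≤ j<p t≤2a))))
  where
  offset : + j - + a + + t ≡ - (+ a) + (+ j + + t)
  offset = reorder (+ j) (+ a) (+ t)
    where
    reorder : ∀ J A T → J - A + T ≡ - A + (J + T)
    reorder = solve-∀
  cancel : ∀ P A → - A + (P + A + A) ≡ P + A
  cancel = solve-∀
  double : ∀ p a → p ℕ.+ 2 ℕ.* a ≡ p ℕ.+ a ℕ.+ a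
  double = solve-∀ᴺ

module _ {n} {p} .{{_ : NonZero p}} {γ : Seq n} where
  open ≡-Reasoning

  Per⇒mod-invariant : ∀ {i} → Per p γ i → ∀ k x m → x ≡ i + + p * m →
    γ (k * + p + x) ≡ γ (k * + p + + (x %ℕ p))
  Per⇒mod-invariant {i} per k x m x≡i+pm = begin
    γ (k * + p + x)              ≡⟨ cong γ shift ⟩
    γ (i + + p * (k + m))        ≡⟨ per (k + m) ⟩
    γ i                          ≡⟨ sym (per (k + m - q)) ⟩
    γ (i + + p * (k + m - q))    ≡⟨ cong γ residue ⟩
    γ (k * + p + + r)            ∎
    where
    r : ℕ
    r = x %ℕ p
    q : ℤ
    q = x /ℕ p

    shift : k * + p + x ≡ i + + p * (k + m)
    shift = trans (cong (λ y → k * + p + y) x≡i+pm) (regroup k (+ p) i m)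
      where
      regroup : ∀ K P I M → K * P + (I + P * M) ≡ I + P * (K + M)
      regroup = solve-∀

    residue : i + + p * (k + m - q) ≡ k * + p + + r
    residue = begin
      i + + p * (k + m - q)               ≡⟨ expand k (+ p) i m q ⟩
      k * + p + (i + + p * m) - q * + p   ≡⟨ cong (λ y → k * + p + y - q * + p) x-divided ⟩
      k * + p + (+ r + q * + p) - q * + p ≡⟨ cancel k (+ p) (+ r) q ⟩
      k * + p + + r                       ∎
      where
      x-divided : i + + p * m ≡ + r + q * + p
      x-divided = trans (sym x≡i+pm) (a≡a%ℕn+[a/ℕn]*n x p)
      expand : ∀ K P I M Q → I + P * (K + M - Q) ≡ K * P + (I + P * M) - Q * P
      expand = solve-∀
      cancel : ∀ K P R Q → K * P + (R + Q * P) - Q * P ≡ K * P + R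
      cancel = solve-∀

  -- A p-block of γ together with the a letters on either side is covered by
  -- [-a, a] and its translate by p, so periodicity on [-a, a] suffices.
  periodicExtension-near-block : ∀ a → (∀ i → - (+ a) ℤ.≤ i → i ℤ.≤ + a → Per p γ i) →
    ∀ k x → - (+ a) ℤ.≤ x → x ℤ.< + p + + a →
    γ (k * + p + x) ≡ periodicExtension p (word γ (k * + p) p) x
  periodicExtension-near-block a per k x -a≤x x<p+a =
    trans (mod-invariant x -a≤x x<p+a) (sym (periodicExtension-word p γ (k * + p) x))
    where
    x≡x+p*0 : ∀ X P → X ≡ X + P * + 0
    x≡x+p*0 = solve-∀
    p+f≡f+p*1 : ∀ P F → P + F ≡ F + P * + 1
    p+f≡f+p*1 = solve-∀

    mod-invariant : ∀ x → - (+ a) ℤ.≤ x → x ℤ.< + p + + a → γ (k * + p + x) ≡ γ (k * + p + + (x %ℕ p))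
    mod-invariant x@(-[1+ _ ]) -a≤x _ =
      Per⇒mod-invariant (per x -a≤x -≤+) k x (+ 0) (x≡x+p*0 x (+ p))
    mod-invariant (+ e) _ (+<+ e<p+a) with e ℕ.<? p
    ... | yes e<p = cong (λ r → γ (k * + p + + r)) (sym (m<n⇒m%n≡m e<p))
    ... | no e≮p  =
      Per⇒mod-invariant (per (+ f) ℤ.neg-≤-pos (+≤+ (ℕ.<⇒≤ f<a))) k (+ e) (+ 1)
        (trans (cong +_ (sym p+f≡e)) (p+f≡f+p*1 (+ p) (+ f)))
      where
      f : ℕ
      f = e ℕ.∸ p
      p+f≡e : p ℕ.+ f ≡ e
      p+f≡e = ℕ.m+[n∸m]≡n (ℕ.≮⇒≥ e≮p)
      f<a : f ℕ.< a
      f<a = ℕ.+-cancelˡ-< p f a (subst (ℕ._< p ℕ.+ a) (sym p+f≡e) e<p+a)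

  word-blockMap : ∀ a (C : BlockCode n a) → (∀ i → - (+ a) ℤ.≤ i → i ℤ.≤ + a → Per p γ i) →
    ∀ k → word (blockMap a C γ) (k * + p) p ≡ cyclicCode a p C (word γ (k * + p) p)
  word-blockMap a C per k = tabulate-cong λ j → cong C (tabulate-cong λ t →
    entry (toℕ<n j) (toℕ≤pred[n] t))
    where
    entry : ∀ {j t} → j ℕ.< p → t ℕ.≤ 2 ℕ.* a →
      γ (k * + p + + j - + a + + t) ≡ periodicExtension p (word γ (k * + p) p) (+ j - + a + + t)
    entry {j} {t} j<p t≤2a =
      let (-a≤x , x<p+a) = window-offset-bounds j<p t≤2a
      in  trans (cong γ (reassoc (k * + p) (+ j) (+ a) (+ t)))
                (periodicExtension-near-block a per k (+ j - + a + + t) -a≤x x<p+a)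
      where
      reassoc : ∀ K J A T → K + J - A + T ≡ K + (J - A + T)
      reassoc = solve-∀

blockMap-cong : ∀ {n} i (C : BlockCode n i) {γ δ : Seq n} → γ ≗ δ → blockMap i C γ ≗ blockMap i C δ
blockMap-cong i C γ≗δ k = cong C (tabulate-cong λ t → γ≗δ (k - + i + + toℕ t))

word-cong : ∀ {n} {γ δ : Seq n} → γ ≗ δ → ∀ k p → word γ k p ≡ word δ k p
word-cong γ≗δ k p = tabulate-cong λ j → γ≗δ (k + + toℕ j)

restrict-interval : ∀ {P : ℤ → Set} {a N} → a ℕ.≤ N →
  (∀ i → - (+ N) ℤ.≤ i → i ℤ.≤ + N → P i) → ∀ i → - (+ a) ℤ.≤ i → i ℤ.≤ + a → P i
restrict-interval a≤N P-on-N i -a≤i i≤a =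
  P-on-N i (ℤ.≤-trans (ℤ.neg-mono-≤ (+≤+ a≤N)) -a≤i) (ℤ.≤-trans i≤a (+≤+ a≤N))

cyclicCode-word : ∀ {n} {p} .{{_ : NonZero p}} {a N} (C : BlockCode n a) {γ δ : Seq n} →
  a ℕ.≤ N → δ ≗ blockMap a C γ → (∀ i → - (+ N) ℤ.≤ i → i ℤ.≤ + N → Per p γ i) →
  ∀ k → cyclicCode a p C (word γ (k * + p) p) ≡ word δ (k * + p) p
cyclicCode-word {p = p} {a} C a≤N δ≗Cγ per k =
  sym (trans (word-cong δ≗Cγ (k * + p) p) (word-blockMap a C (restrict-interval a≤N per) k))

lemma3p1 : (n : ℕ) → 2 ≤ n → (τ τ' : Seq n) → ToeplitzSubshift τ → ToeplitzSubshift τ'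
    → (c : Conjugacy (OrbitClosure τ) (OrbitClosure τ'))
    → (α β : Seq n) → OrbitClosure τ α → OrbitClosure τ' β
    → (∀ (k : ℤ) → Conjugacy.π c α k ≡ β k)
    → (N : ℕ) → ConjNorm c N
    → (p : ℕ) → 1 ≤ p
    → (∀ (i : ℤ) → - (+ N) ℤ.≤ i → i ℤ.≤ + N → Per p α i)
    → (∀ (i : ℤ) → - (+ N) ℤ.≤ i → i ℤ.≤ + N → Per p β i)
    → Σ (Vec (Fin n) p ↔ Vec (Fin n) p) λ φ →
        ∀ (k : ℤ) → Inverse.to φ (word α (k * + p) p) ≡ word β (k * + p) p
lemma3p1 n _ τ τ' _ _ c α β α∈O _ πα≡β N (a , a' , ((C , C-induces) , _) , ((C' , C'-induces) , _) , N≡a⊔a')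
         p 1≤p perα perβ =
  let (φ , φ-extends) = ↔-extending-retraction (≡-decᵛ _≟ᶠ_) (vectors (allFin n) p) (∈-vectors ∈-allFin) F G
  in  φ , λ k → trans (φ-extends (word α (k * + p) p) (G∘F-on-α k)) (F-on-α k)
  where
  open Conjugacy c
  instance
    p-nonZero : NonZero p
    p-nonZero = >-nonZero 1≤p

  β≗Cα : β ≗ blockMap a C α
  β≗Cα x = trans (sym (πα≡β x)) (C-induces α α∈O x)

  α≗C'β : α ≗ blockMap a' C' β
  α≗C'β x = trans (sym (left-inv α α∈O x))
    (trans (C'-induces (π α) (maps α α∈O) x) (blockMap-cong a' C' πα≡β x))

  F G : Vec (Fin n) p → Vec (Fin n) p
  F = cyclicCode a p C
  G = cyclicCode a' p C'

  F-on-α : ∀ k → F (word α (k * + p) p) ≡ word β (k * + p) p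
  F-on-α = cyclicCode-word C (subst (a ℕ.≤_) (sym N≡a⊔a') (ℕ.m≤m⊔n a a')) β≗Cα perα

  G∘F-on-α : ∀ k → G (F (word α (k * + p) p)) ≡ word α (k * + p) p
  G∘F-on-α k = trans (cong G (F-on-α k))
    (cyclicCode-word C' (subst (a' ℕ.≤_) (sym N≡a⊔a') (ℕ.m≤n⊔m a a')) α≗C'β perβ k)
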